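{- Let $n\in\overline{C_2}$ and $\mu=\mathrm{ord}_n(2)$. Then $\mu$ is even, the collection $A=\{\{2^{2i},2^{2i+1}\}\}_{i=0}^{(\mu-2)/2}$ (residues modulo $n$) is a partition of the set $\langle 2\rangle_n=\{2^k \bmod n: k\ge0\}$ into pairs, and $\Delta A=\langle 2\rangle_n$.
   Context: $\mathrm{ord}_n(x)$ is the multiplicative order of a unit $x$ modulo $n$. $C_2$ is the set of (odd) primes $p$ with $\mathrm{ord}_p(2)\equiv2\pmod4$; $\overline{C_2}$ is the set of all products of one or more (not necessarily distinct) primes from $C_2$. For a set $A=\{\{x_i,y_i\}\}_{i=1}^k$ of pairs of residues modulo $n$, $\Delta A=\{\pm(x_i-y_i)\bmod n\}_{i=1}^k$ (as a set). -}

module Defs where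

open import Data.Nat using (ℕ; zero; suc; _≤_; _<_; _^_; _*_; _+_; _∸_; _/_; _%_)
open import Data.Nat.Primality using (Prime)
open import Data.Integer as ℤ using (ℤ; +_)
open import Data.Integer.Divisibility as ℤd using ()
open import Data.Product using (_×_; ∃; Σ)
open import Data.Sum using (_⊎_)
open import Relation.Nullary using (¬_)
open import Relation.Binary.PropositionalEquality using (_≡_)

infix 4 _≡_[modℤ_] _≡_[mod_]

_≡_[modℤ_] : ℤ → ℤ → ℕ → Set
a ≡ b [modℤ n ] = (+ n) ℤd.∣ (a ℤ.- b)

_≡_[mod_] : ℕ → ℕ → ℕ → Set
a ≡ b [mod n ] = (+ a) ≡ (+ b) [modℤ n ]

IsOrd : ℕ → ℕ → ℕ → Set
IsOrd n x μ = (0 < μ) × (x ^ μ ≡ 1 [mod n ]) ×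
              (∀ k → 0 < k → x ^ k ≡ 1 [mod n ] → μ ≤ k)

C₂ : ℕ → Set
C₂ p = Prime p × (p % 2 ≡ 1) × ∃ λ μ → IsOrd p 2 μ × (μ % 4 ≡ 2)

-- closure of C₂ under products of one or more (not nec. distinct) elements
data C₂bar : ℕ → Set where
  single : ∀ {p} → C₂ p → C₂bar p
  mul    : ∀ {p m} → C₂ p → C₂bar m → C₂bar (p * m)

-- residues mod n are represented by their canonical representatives in [0, n)
-- ⟨2⟩ₙ = { 2^k mod n : k ≥ 0 }
InPow2 : ℕ → ℕ → Set
InPow2 n x = (x < n) × ∃ λ k → x ≡ 2 ^ k [mod n ]

InRange : ℕ → ℕ → Set
InRange μ i = i ≤ (μ ∸ 2) / 2

InPair : ℕ → ℕ → ℕ → Set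
InPair n i x = (x < n) × ((x ≡ 2 ^ (2 * i) [mod n ]) ⊎ (x ≡ 2 ^ (2 * i + 1) [mod n ]))

InΔA : ℕ → ℕ → ℕ → Set
InΔA n μ x = (x < n) × ∃ λ i → InRange μ i ×
  (((+ x) ≡ (+ (2 ^ (2 * i)) ℤ.- + (2 ^ (2 * i + 1))) [modℤ n ])
   ⊎ ((+ x) ≡ (+ (2 ^ (2 * i + 1)) ℤ.- + (2 ^ (2 * i))) [modℤ n ]))

{-# OPTIONS --safe #-}
-- For n ∈ C₂bar there is an odd h with 2^h ≡ -1 (mod n). For a prime p ∈ C₂ take h = ord_p(2)/2:
-- 2^h is a square root of 1 other than 1, hence -1. The property passes to products p·m (p and m
-- need not be coprime) because a ≡ -1 modulo both p and m forces a^p ≡ -1 (mod p·m).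
-- Consequently μ is even, the powers 2^0, …, 2^(μ-1) are distinct and split into the pairs
-- {2^(2i), 2^(2i+1)}, and the differences ±2^(2i) are the even powers together with their
-- negatives -2^(2i) ≡ 2^(2i+h), which are exactly the odd powers.
module Submission where

open import Defs
open import Data.Nat using (ℕ; _*_; _+_; _^_)
open import Data.Nat.Divisibility using (_∣_)
open import Data.Product using (_×_; ∃)
open import Function.Bundles using (_⇔_)
open import Relation.Nullary using (¬_)
open import Relation.Binary.PropositionalEquality using (_≡_)

open import Data.Nat using (zero; suc; _≤_; _<_; _∸_; _/_; _%_; z≤n; s≤s; NonZero)
import Data.Nat as ℕ
import Data.Nat.Properties as ℕ
import Data.Nat.Divisibility as ℕ
open import Data.Nat.DivMod
  using (m≡m%n+[m/n]*n; m%n<n; m/n*n≡m; [m∸n]/n≡m/n∸1; m%n*o≡m*o%[n*o])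
open import Data.Nat.Primality using (Prime; euclidsLemma; prime⇒nonTrivial)
open import Data.Integer as ℤ using (ℤ; +_; 0ℤ; 1ℤ; -1ℤ)
import Data.Integer.Properties as ℤ
import Data.Integer.Divisibility.Signed as ℤ
open import Data.Integer.Tactic.RingSolver using (solve-∀)
open import Data.Nat.Tactic.RingSolver using () renaming (solve-∀ to ℕ-solve-∀)
open import Data.Product using (_,_; proj₁; proj₂)
open import Data.Sum using (_⊎_; inj₁; inj₂; fromInj₂)
import Data.Sum as Sum
open import Data.Empty using (⊥-elim)
open import Function using (_∘_)
open import Function.Bundles using (mk⇔; module Equivalence)
open import Level using (0ℓ)
open import Relation.Binary.Bundles using (Setoid)
open import Relation.Binary.Structures using (IsEquivalence)
open import Relation.Binary.Definitions using (tri<; tri≈; tri>)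
open import Relation.Binary.PropositionalEquality
  using (refl; sym; trans; cong; cong₂; subst; subst₂; module ≡-Reasoning)
import Relation.Binary.Reasoning.Setoid as SetoidReasoning

infix 4 _≈_⟨mod_⟩

-- A record rather than `_≡_[modℤ_]` itself, so that a and b can be inferred from a proof.
record _≈_⟨mod_⟩ (a b : ℤ) (n : ℕ) : Set where
  constructor mod
  field ∣-difference : + n ℤ.∣ a ℤ.- b

module _ {n : ℕ} where

  ≈-reflexive : ∀ {a b} → a ≡ b → a ≈ b ⟨mod n ⟩
  ≈-reflexive {a} refl = mod (ℤ.divides 0ℤ (ℤ.+-inverseʳ a))

  ≈-refl : ∀ {a} → a ≈ a ⟨mod n ⟩
  ≈-refl = ≈-reflexive refl

  ≈-sym : ∀ {a b} → a ≈ b ⟨mod n ⟩ → b ≈ a ⟨mod n ⟩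
  ≈-sym {a} {b} (mod d) = mod (subst (+ n ℤ.∣_) (identity a b) (ℤ.∣m⇒∣-m d))
    where
    identity : ∀ a b → ℤ.- (a ℤ.- b) ≡ b ℤ.- a
    identity = solve-∀

  ≈-trans : ∀ {a b c} → a ≈ b ⟨mod n ⟩ → b ≈ c ⟨mod n ⟩ → a ≈ c ⟨mod n ⟩
  ≈-trans {a} {b} {c} (mod d) (mod e) = mod (subst (+ n ℤ.∣_) (identity a b c) (ℤ.∣m∣n⇒∣m+n d e))
    where
    identity : ∀ a b c → (a ℤ.- b) ℤ.+ (b ℤ.- c) ≡ a ℤ.- c
    identity = solve-∀

  ≈-isEquivalence : IsEquivalence _≈_⟨mod n ⟩
  ≈-isEquivalence = record { refl = ≈-refl ; sym = ≈-sym ; trans = ≈-trans }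

  +-cong : ∀ {a b c d} → a ≈ b ⟨mod n ⟩ → c ≈ d ⟨mod n ⟩ → a ℤ.+ c ≈ b ℤ.+ d ⟨mod n ⟩
  +-cong {a} {b} {c} {d} (mod e) (mod f) = mod (subst (+ n ℤ.∣_) (identity a b c d) (ℤ.∣m∣n⇒∣m+n e f))
    where
    identity : ∀ a b c d → (a ℤ.- b) ℤ.+ (c ℤ.- d) ≡ (a ℤ.+ c) ℤ.- (b ℤ.+ d)
    identity = solve-∀

  *-cong : ∀ {a b c d} → a ≈ b ⟨mod n ⟩ → c ≈ d ⟨mod n ⟩ → a ℤ.* c ≈ b ℤ.* d ⟨mod n ⟩
  *-cong {a} {b} {c} {d} (mod e) (mod f) =
    mod (subst (+ n ℤ.∣_) (identity a b c d) (ℤ.∣m∣n⇒∣m+n (ℤ.∣m⇒∣m*n c e) (ℤ.∣n⇒∣m*n b f)))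
    where
    identity : ∀ a b c d → (a ℤ.- b) ℤ.* c ℤ.+ b ℤ.* (c ℤ.- d) ≡ a ℤ.* c ℤ.- b ℤ.* d
    identity = solve-∀

  neg-cong : ∀ {a b} → a ≈ b ⟨mod n ⟩ → ℤ.- a ≈ ℤ.- b ⟨mod n ⟩
  neg-cong {a} {b} (mod d) = mod (subst (+ n ℤ.∣_) (identity a b) (ℤ.∣m⇒∣-m d))
    where
    identity : ∀ a b → ℤ.- (a ℤ.- b) ≡ ℤ.- a ℤ.- ℤ.- b
    identity = solve-∀

  ^-cong : ∀ {a b} k → a ≈ b ⟨mod n ⟩ → a ℤ.^ k ≈ b ℤ.^ k ⟨mod n ⟩
  ^-cong zero    a≈b = ≈-refl
  ^-cong (suc k) a≈b = *-cong a≈b (^-cong k a≈b)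

  ≈0⇒∣ : ∀ {a} → a ≈ 0ℤ ⟨mod n ⟩ → + n ℤ.∣ a
  ≈0⇒∣ {a} (mod d) = subst (+ n ℤ.∣_) (ℤ.+-identityʳ a) d

  n≈0 : + n ≈ 0ℤ ⟨mod n ⟩
  n≈0 = mod (ℤ.divides 1ℤ (trans (ℤ.+-identityʳ (+ n)) (sym (ℤ.*-identityˡ (+ n)))))

  ≈-1⇔∣1+ : ∀ {a} → a ≈ -1ℤ ⟨mod n ⟩ ⇔ + n ℤ.∣ 1ℤ ℤ.+ a
  ≈-1⇔∣1+ {a} = mk⇔ (λ (mod d) → subst (+ n ℤ.∣_) (identity a) d)
                    (λ d → mod (subst (+ n ℤ.∣_) (sym (identity a)) d))
    where
    identity : ∀ a → a ℤ.- -1ℤ ≡ 1ℤ ℤ.+ a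
    identity = solve-∀

  ≡modℤ⇒≈ : ∀ {a b} → a ≡ b [modℤ n ] → a ≈ b ⟨mod n ⟩
  ≡modℤ⇒≈ d = mod (ℤ.∣ᵤ⇒∣ d)

  ≈⇒≡modℤ : ∀ {a b} → a ≈ b ⟨mod n ⟩ → a ≡ b [modℤ n ]
  ≈⇒≡modℤ (mod d) = ℤ.∣⇒∣ᵤ d

  -1≉1 : 2 < n → ¬ (-1ℤ ≈ 1ℤ ⟨mod n ⟩)
  -1≉1 2<n (mod d) = ℕ.<⇒≱ 2<n (ℕ.∣⇒≤ (ℤ.∣⇒∣ᵤ d))

≈-setoid : ℕ → Setoid 0ℓ 0ℓ
≈-setoid n = record { isEquivalence = ≈-isEquivalence {n} }

module ≈-Reasoning (n : ℕ) = SetoidReasoning (≈-setoid n)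

pos-^ : ∀ m k → + (m ^ k) ≡ (+ m) ℤ.^ k
pos-^ m zero    = refl
pos-^ m (suc k) = trans (ℤ.pos-* m (m ^ k)) (cong (+ m ℤ.*_) (pos-^ m k))

pos-^-distribˡ-+-* : ∀ m a b → + (m ^ (a + b)) ≡ + (m ^ a) ℤ.* + (m ^ b)
pos-^-distribˡ-+-* m a b = trans (cong +_ (ℕ.^-distribˡ-+-* m a b)) (ℤ.pos-* (m ^ a) (m ^ b))

pos-^-*-assoc : ∀ m a b → + (m ^ (a * b)) ≡ (+ (m ^ a)) ℤ.^ b
pos-^-*-assoc m a b = trans (cong +_ (sym (ℕ.^-*-assoc m a b))) (pos-^ (m ^ a) b)

-1^[1+2k]≡-1 : ∀ k → -1ℤ ℤ.^ (1 + 2 * k) ≡ -1ℤ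
-1^[1+2k]≡-1 k = begin
  -1ℤ ℤ.* -1ℤ ℤ.^ (2 * k)    ≡⟨ cong (-1ℤ ℤ.*_) (ℤ.^-*-assoc -1ℤ 2 k) ⟨
  -1ℤ ℤ.* (-1ℤ ℤ.^ 2) ℤ.^ k  ≡⟨ cong (-1ℤ ℤ.*_) (ℤ.^-zeroˡ k) ⟩
  -1ℤ                        ∎
  where open ≡-Reasoning

^-odd-≈-1 : ∀ {n a} k → a ≈ -1ℤ ⟨mod n ⟩ → a ℤ.^ (1 + 2 * k) ≈ -1ℤ ⟨mod n ⟩
^-odd-≈-1 k a≈-1 = ≈-trans (^-cong (1 + 2 * k) a≈-1) (≈-reflexive (-1^[1+2k]≡-1 k))

^-≈1 : ∀ {n a} k → a ≈ 1ℤ ⟨mod n ⟩ → a ℤ.^ k ≈ 1ℤ ⟨mod n ⟩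
^-≈1 k a≈1 = ≈-trans (^-cong k a≈1) (≈-reflexive (ℤ.^-zeroˡ k))

-- alternatingSum a c = Σ_{j ≤ 2c} (-a)^j
alternatingSum : ℤ → ℕ → ℤ
alternatingSum a zero    = 1ℤ
alternatingSum a (suc c) = 1ℤ ℤ.- a ℤ.+ a ℤ.* a ℤ.* alternatingSum a c

1+a^[1+2c]≡[1+a]*alternatingSum : ∀ a c →
  1ℤ ℤ.+ a ℤ.^ (1 + 2 * c) ≡ (1ℤ ℤ.+ a) ℤ.* alternatingSum a c
1+a^[1+2c]≡[1+a]*alternatingSum a zero    = identity a
  where
  identity : ∀ a → 1ℤ ℤ.+ a ℤ.* 1ℤ ≡ (1ℤ ℤ.+ a) ℤ.* 1ℤ
  identity = solve-∀
1+a^[1+2c]≡[1+a]*alternatingSum a (suc c) = begin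
  1ℤ ℤ.+ a ℤ.^ (1 + 2 * suc c)                         ≡⟨ cong (λ e → 1ℤ ℤ.+ a ℤ.^ e) (cong suc (ℕ.*-suc 2 c)) ⟩
  1ℤ ℤ.+ a ℤ.* (a ℤ.* x)                               ≡⟨ cong (λ y → 1ℤ ℤ.+ a ℤ.* (a ℤ.* y)) x≡[1+a]F-1 ⟩
  1ℤ ℤ.+ a ℤ.* (a ℤ.* ((1ℤ ℤ.+ a) ℤ.* F ℤ.- 1ℤ))       ≡⟨ identity a F ⟩
  (1ℤ ℤ.+ a) ℤ.* alternatingSum a (suc c)              ∎
  where
  open ≡-Reasoning
  x = a ℤ.^ (1 + 2 * c)
  F = alternatingSum a c
  x≡[1+a]F-1 : x ≡ (1ℤ ℤ.+ a) ℤ.* F ℤ.- 1ℤ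
  x≡[1+a]F-1 = trans (1+y-1 x) (cong (ℤ._- 1ℤ) (1+a^[1+2c]≡[1+a]*alternatingSum a c))
    where
    1+y-1 : ∀ y → y ≡ (1ℤ ℤ.+ y) ℤ.- 1ℤ
    1+y-1 = solve-∀
  identity : ∀ a F → 1ℤ ℤ.+ a ℤ.* (a ℤ.* ((1ℤ ℤ.+ a) ℤ.* F ℤ.- 1ℤ))
                   ≡ (1ℤ ℤ.+ a) ℤ.* (1ℤ ℤ.- a ℤ.+ a ℤ.* a ℤ.* F)
  identity = solve-∀

alternatingSum-≈ : ∀ {n a} c → a ≈ -1ℤ ⟨mod n ⟩ → alternatingSum a c ≈ + (1 + 2 * c) ⟨mod n ⟩
alternatingSum-≈         zero    a≈-1 = ≈-refl
alternatingSum-≈ {n} {a} (suc c) a≈-1 = begin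
  1ℤ ℤ.- a ℤ.+ a ℤ.* a ℤ.* alternatingSum a c
    ≈⟨ +-cong (+-cong (≈-refl {a = 1ℤ}) (neg-cong a≈-1)) (*-cong (*-cong a≈-1 a≈-1) (alternatingSum-≈ c a≈-1)) ⟩
  1ℤ ℤ.- -1ℤ ℤ.+ -1ℤ ℤ.* -1ℤ ℤ.* + (1 + 2 * c)  ≡⟨ identity (+ (1 + 2 * c)) ⟩
  + 2 ℤ.+ + (1 + 2 * c)                          ≡⟨ ℤ.pos-+ 2 (1 + 2 * c) ⟨
  + (2 + (1 + 2 * c))                            ≡⟨ cong (λ e → + (1 + e)) (ℕ.*-suc 2 c) ⟨
  + (1 + 2 * suc c)                              ∎
  where
  open ≈-Reasoning n
  identity : ∀ y → 1ℤ ℤ.- -1ℤ ℤ.+ -1ℤ ℤ.* -1ℤ ℤ.* y ≡ + 2 ℤ.+ y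
  identity = solve-∀

*-pres-∣ : ∀ {i j x y} → i ℤ.∣ x → j ℤ.∣ y → i ℤ.* j ℤ.∣ x ℤ.* y
*-pres-∣ {j = j} {x = x} i∣x j∣y = ℤ.∣-trans (ℤ.*-monoˡ-∣ j i∣x) (ℤ.*-monoʳ-∣ x j∣y)

-- In 1 + a^p = (1 + a) · alternatingSum a c, m divides the first factor and p the second.
^-≈-1-lift : ∀ {m a} c → a ≈ -1ℤ ⟨mod 1 + 2 * c ⟩ → a ≈ -1ℤ ⟨mod m ⟩ →
             a ℤ.^ (1 + 2 * c) ≈ -1ℤ ⟨mod (1 + 2 * c) * m ⟩
^-≈-1-lift {m} {a} c a≈-1[p] a≈-1[m] =
  Equivalence.from ≈-1⇔∣1+ (subst₂ ℤ._∣_ (sym (ℤ.pos-* p m)) product≡1+a^p (*-pres-∣ p∣sum m∣1+a))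
  where
  p = 1 + 2 * c
  p∣sum : + p ℤ.∣ alternatingSum a c
  p∣sum = ≈0⇒∣ (≈-trans (alternatingSum-≈ c a≈-1[p]) n≈0)
  m∣1+a : + m ℤ.∣ 1ℤ ℤ.+ a
  m∣1+a = Equivalence.to ≈-1⇔∣1+ a≈-1[m]
  product≡1+a^p : alternatingSum a c ℤ.* (1ℤ ℤ.+ a) ≡ 1ℤ ℤ.+ a ℤ.^ p
  product≡1+a^p = trans (ℤ.*-comm (alternatingSum a c) (1ℤ ℤ.+ a)) (sym (1+a^[1+2c]≡[1+a]*alternatingSum a c))

prime⇒√1≈±1 : ∀ {p x} → Prime p → x ℤ.* x ≈ 1ℤ ⟨mod p ⟩ → x ≈ 1ℤ ⟨mod p ⟩ ⊎ x ≈ -1ℤ ⟨mod p ⟩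
prime⇒√1≈±1 {p} {x} p-prime x²≈1 =
  Sum.map ≡modℤ⇒≈ ≡modℤ⇒≈ (euclidsLemma ℤ.∣ x ℤ.- 1ℤ ∣ ℤ.∣ x ℤ.- -1ℤ ∣ p-prime p∣product)
  where
  factorise : ∀ x → x ℤ.* x ℤ.- 1ℤ ≡ (x ℤ.- 1ℤ) ℤ.* (x ℤ.- -1ℤ)
  factorise = solve-∀
  p∣product : p ℕ.∣ ℤ.∣ x ℤ.- 1ℤ ∣ ℕ.* ℤ.∣ x ℤ.- -1ℤ ∣
  p∣product = subst (p ℕ.∣_) (trans (cong ℤ.∣_∣ (factorise x)) (ℤ.abs-* (x ℤ.- 1ℤ) (x ℤ.- -1ℤ))) (≈⇒≡modℤ x²≈1)

[1+2a]*[1+2b]≡1+2[a+b+2ab] : ∀ a b → (1 + 2 * a) * (1 + 2 * b) ≡ 1 + 2 * (a + b + 2 * a * b)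
[1+2a]*[1+2b]≡1+2[a+b+2ab] = ℕ-solve-∀

odd-power-≈-1-* : ∀ {m} g c s t → + (g ^ (1 + 2 * s)) ≈ -1ℤ ⟨mod 1 + 2 * c ⟩ →
                  + (g ^ (1 + 2 * t)) ≈ -1ℤ ⟨mod m ⟩ →
                  + (g ^ ((1 + 2 * s) * (1 + 2 * t) * (1 + 2 * c))) ≈ -1ℤ ⟨mod (1 + 2 * c) * m ⟩
odd-power-≈-1-* g c s t g^hs≈-1 g^ht≈-1 = ≈-trans
  (≈-reflexive (pos-^-*-assoc g (hs * ht) (1 + 2 * c)))
  (^-≈-1-lift c (≈-trans (≈-reflexive (pos-^-*-assoc g hs ht)) (^-odd-≈-1 t g^hs≈-1))
                (≈-trans (≈-reflexive (trans (cong (λ e → + (g ^ e)) (ℕ.*-comm hs ht))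
                                             (pos-^-*-assoc g ht hs)))
                         (^-odd-≈-1 s g^ht≈-1)))
  where
  hs = 1 + 2 * s
  ht = 1 + 2 * t

C₂⇒odd : ∀ {p} → C₂ p → p ≡ 1 + 2 * (p / 2)
C₂⇒odd {p} (_ , p%2≡1 , _) = trans (m≡m%n+[m/n]*n p 2) (cong₂ _+_ p%2≡1 (ℕ.*-comm (p / 2) 2))

C₂⇒2< : ∀ {p} → C₂ p → 2 < p
C₂⇒2< {p} (p-prime , p%2≡1 , _) =
  ℕ.≤∧≢⇒< (ℕ.nonTrivial⇒n>1 p {{prime⇒nonTrivial p-prime}}) (λ 2≡p → 0≢1 (trans (cong (_% 2) 2≡p) p%2≡1))
  where
  0≢1 : ¬ (0 ≡ 1)
  0≢1 ()

C₂⇒2^odd≈-1 : ∀ {p} → C₂ p → ∃ λ t → + (2 ^ (1 + 2 * t)) ≈ -1ℤ ⟨mod p ⟩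
C₂⇒2^odd≈-1 {p} (p-prime , _ , μ , (_ , 2^μ≡1 , μ-least) , μ%4≡2) =
  μ / 4 , fromInj₂ (⊥-elim ∘ 2^h≉1) (prime⇒√1≈±1 p-prime 2^h*2^h≈1)
  where
  h = 1 + 2 * (μ / 4)
  μ≡h+h : μ ≡ h + h
  μ≡h+h = trans (m≡m%n+[m/n]*n μ 4) (trans (cong (_+ μ / 4 * 4) μ%4≡2) (identity (μ / 4)))
    where
    identity : ∀ q → 2 + q * 4 ≡ (1 + 2 * q) + (1 + 2 * q)
    identity = ℕ-solve-∀
  2^h*2^h≈1 : + (2 ^ h) ℤ.* + (2 ^ h) ≈ 1ℤ ⟨mod p ⟩
  2^h*2^h≈1 = ≈-trans (≈-reflexive (sym (pos-^-distribˡ-+-* 2 h h)))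
                      (subst (λ e → + (2 ^ e) ≈ 1ℤ ⟨mod p ⟩) μ≡h+h (≡modℤ⇒≈ 2^μ≡1))
  2^h≉1 : ¬ (+ (2 ^ h) ≈ 1ℤ ⟨mod p ⟩)
  2^h≉1 2^h≈1 = ℕ.<⇒≱ (ℕ.m<m+n h (s≤s z≤n))
                      (subst (_≤ h) μ≡h+h (μ-least h (s≤s z≤n) (≈⇒≡modℤ 2^h≈1)))

C₂bar⇒2< : ∀ {n} → C₂bar n → 2 < n
C₂bar⇒2< (single c) = C₂⇒2< c
C₂bar⇒2< (mul c b)  = ℕ.*-mono-≤ (C₂⇒2< c) (ℕ.≤-trans (s≤s z≤n) (C₂bar⇒2< b))

C₂bar⇒2^odd≈-1 : ∀ {n} → C₂bar n → ∃ λ t → + (2 ^ (1 + 2 * t)) ≈ -1ℤ ⟨mod n ⟩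
C₂bar⇒2^odd≈-1 (single c) = C₂⇒2^odd≈-1 c
C₂bar⇒2^odd≈-1 (mul {p} {m} c b) with C₂⇒2^odd≈-1 c | C₂bar⇒2^odd≈-1 b
... | s , 2^hs≈-1[p] | t , 2^ht≈-1[m] =
  u + k + 2 * u * k ,
  subst₂ (λ e q → + (2 ^ e) ≈ -1ℤ ⟨mod q ⟩) exponent≡ (cong (_* m) (sym p≡))
    (odd-power-≈-1-* 2 k s t (subst (λ q → + (2 ^ (1 + 2 * s)) ≈ -1ℤ ⟨mod q ⟩) p≡ 2^hs≈-1[p]) 2^ht≈-1[m])
  where
  k = p / 2
  p≡ = C₂⇒odd c
  u = s + t + 2 * s * t
  exponent≡ : (1 + 2 * s) * (1 + 2 * t) * (1 + 2 * k) ≡ 1 + 2 * (u + k + 2 * u * k)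
  exponent≡ = trans (cong (_* (1 + 2 * k)) ([1+2a]*[1+2b]≡1+2[a+b+2ab] s t)) ([1+2a]*[1+2b]≡1+2[a+b+2ab] u k)

data PairExponent (i : ℕ) : ℕ → Set where
  even : PairExponent i (2 * i)
  odd  : PairExponent i (2 * i + 1)

pairExponent-exists : ∀ e → ∃ λ i → PairExponent i e
pairExponent-exists zero = 0 , even
pairExponent-exists (suc e) with pairExponent-exists e
... | i , even = i , subst (PairExponent i) (ℕ.+-comm (2 * i) 1) odd
... | i , odd  = suc i , subst (PairExponent (suc i)) (identity i) even
  where
  identity : ∀ i → 2 * suc i ≡ suc (2 * i + 1)
  identity = ℕ-solve-∀

pairExponent-unique : ∀ {i j e f} → PairExponent i e → PairExponent j f → e ≡ f → i ≡ j
pairExponent-unique {i} {j} even even eq = ℕ.*-cancelˡ-≡ i j 2 eq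
pairExponent-unique {i} {j} odd  odd  eq = ℕ.*-cancelˡ-≡ i j 2 (ℕ.+-cancelʳ-≡ 1 (2 * i) (2 * j) eq)
pairExponent-unique {i} {j} even odd  eq = ⊥-elim (ℕ.even≢odd i j (trans eq (ℕ.+-comm (2 * j) 1)))
pairExponent-unique {i} {j} odd  even eq = ⊥-elim (ℕ.even≢odd j i (trans (sym eq) (ℕ.+-comm (2 * i) 1)))

pairExponent-<⇔ : ∀ {i e} ν → PairExponent i e → e < ν * 2 ⇔ i < ν
pairExponent-<⇔ {i} {e} ν pe = mk⇔
  (λ e<2ν → ℕ.*-cancelˡ-< 2 i ν (ℕ.≤-<-trans (2i≤e pe) (subst (e <_) (ℕ.*-comm ν 2) e<2ν)))
  (λ i<ν → ℕ.≤-trans (subst (suc e ≤_) (identity i) (s≤s (e≤2i+1 pe))) (ℕ.*-monoˡ-≤ 2 i<ν))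
  where
  2i≤e : ∀ {e} → PairExponent i e → 2 * i ≤ e
  2i≤e even = ℕ.≤-refl
  2i≤e odd  = ℕ.m≤m+n (2 * i) 1
  e≤2i+1 : ∀ {e} → PairExponent i e → e ≤ 2 * i + 1
  e≤2i+1 even = ℕ.m≤m+n (2 * i) 1
  e≤2i+1 odd  = ℕ.≤-refl
  identity : ∀ i → suc (2 * i + 1) ≡ suc i * 2
  identity = ℕ-solve-∀

inRange⇔< : ∀ μ {i} → .{{NonZero (μ / 2)}} → InRange μ i ⇔ i < μ / 2
inRange⇔< μ {i} = mk⇔
  (λ i≤ → ℕ.m≤pred[n]⇒suc[m]≤n (subst (i ≤_) ([m∸n]/n≡m/n∸1 μ 2) i≤))
  (λ i< → subst (i ≤_) (sym ([m∸n]/n≡m/n∸1 μ 2)) (ℕ.<⇒≤pred i<))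

^-reduce : ∀ {n} g d .{{_ : NonZero d}} → + (g ^ d) ≈ 1ℤ ⟨mod n ⟩ →
           ∀ k → + (g ^ k) ≈ + (g ^ (k % d)) ⟨mod n ⟩
^-reduce {n} g d g^d≈1 k = begin
  + (g ^ k)                                ≡⟨ cong (λ e → + (g ^ e)) (m≡m%n+[m/n]*n k d) ⟩
  + (g ^ (k % d + k / d * d))              ≡⟨ pos-^-distribˡ-+-* g (k % d) (k / d * d) ⟩
  + (g ^ (k % d)) ℤ.* + (g ^ (k / d * d))  ≈⟨ *-cong (≈-refl {a = + (g ^ (k % d))}) g^[qd]≈1 ⟩
  + (g ^ (k % d)) ℤ.* 1ℤ                   ≡⟨ ℤ.*-identityʳ (+ (g ^ (k % d))) ⟩
  + (g ^ (k % d))                          ∎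
  where
  open ≈-Reasoning n
  g^[qd]≈1 : + (g ^ (k / d * d)) ≈ 1ℤ ⟨mod n ⟩
  g^[qd]≈1 = ≈-trans (≈-reflexive (trans (cong (λ e → + (g ^ e)) (ℕ.*-comm (k / d) d))
                                         (pos-^-*-assoc g d (k / d))))
                     (^-≈1 (k / d) g^d≈1)

2^[e+1]-2^e≡2^e : ∀ e → + (2 ^ (e + 1)) ℤ.- + (2 ^ e) ≡ + (2 ^ e)
2^[e+1]-2^e≡2^e e = trans (cong (ℤ._- + (2 ^ e)) (pos-^-distribˡ-+-* 2 e 1)) (identity (+ (2 ^ e)))
  where
  identity : ∀ y → y ℤ.* + 2 ℤ.- y ≡ y
  identity = solve-∀

2^e-2^[e+1]≡-2^e : ∀ e → + (2 ^ e) ℤ.- + (2 ^ (e + 1)) ≡ ℤ.- + (2 ^ e)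
2^e-2^[e+1]≡-2^e e = trans (cong (λ y → + (2 ^ e) ℤ.- y) (pos-^-distribˡ-+-* 2 e 1)) (identity (+ (2 ^ e)))
  where
  identity : ∀ y → y ℤ.- y ℤ.* + 2 ≡ ℤ.- y
  identity = solve-∀

inPair⇒exponent : ∀ {n i x} → InPair n i x → ∃ λ e → PairExponent i e × + x ≈ + (2 ^ e) ⟨mod n ⟩
inPair⇒exponent {i = i} (_ , inj₁ x≡2^e) = 2 * i     , even , ≡modℤ⇒≈ x≡2^e
inPair⇒exponent {i = i} (_ , inj₂ x≡2^e) = 2 * i + 1 , odd  , ≡modℤ⇒≈ x≡2^e

exponent⇒inPair : ∀ {n i e x} → x < n → PairExponent i e → + x ≈ + (2 ^ e) ⟨mod n ⟩ → InPair n i x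
exponent⇒inPair x<n even x≈2^e = x<n , inj₁ (≈⇒≡modℤ x≈2^e)
exponent⇒inPair x<n odd  x≈2^e = x<n , inj₂ (≈⇒≡modℤ x≈2^e)

module PowersOfTwo {n μ : ℕ} (0<μ : 0 < μ) (2^μ≡1 : 2 ^ μ ≡ 1 [mod n ])
                   (μ-least : ∀ k → 0 < k → 2 ^ k ≡ 1 [mod n ] → μ ≤ k)
                   (2<n : 2 < n) {t : ℕ} (2^h≈-1 : + (2 ^ (1 + 2 * t)) ≈ -1ℤ ⟨mod n ⟩) where

  h : ℕ
  h = 1 + 2 * t

  instance
    μ-nonZero : NonZero μ
    μ-nonZero = ℕ.>-nonZero 0<μ

  2^μ≈1 : + (2 ^ μ) ≈ 1ℤ ⟨mod n ⟩
  2^μ≈1 = ≡modℤ⇒≈ 2^μ≡1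

  -- Multiplying 2^a ≡ 2^b by 2^(μ - a) gives 1 ≡ 2^(b - a), contradicting the minimality of μ.
  2^-distinct : ∀ {a b} → a < b → b < μ → ¬ (+ (2 ^ a) ≈ + (2 ^ b) ⟨mod n ⟩)
  2^-distinct {a} {b} a<b b<μ 2^a≈2^b =
    ℕ.<⇒≱ (ℕ.≤-<-trans (ℕ.m∸n≤m b a) b<μ) (μ-least d (ℕ.m<n⇒0<n∸m a<b) (≈⇒≡modℤ 2^d≈1))
    where
    d = b ∸ a
    c = μ ∸ a
    μ+d≡c+b : μ + d ≡ c + b
    μ+d≡c+b = begin
      μ + d        ≡⟨ cong (_+ d) (ℕ.m∸n+n≡m (ℕ.<⇒≤ (ℕ.<-trans a<b b<μ))) ⟨
      c + a + d    ≡⟨ ℕ.+-assoc c a d ⟩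
      c + (a + d)  ≡⟨ cong (λ y → c + y) (ℕ.m+[n∸m]≡n (ℕ.<⇒≤ a<b)) ⟩
      c + b        ∎
      where open ≡-Reasoning
    2^d≈1 : + (2 ^ d) ≈ 1ℤ ⟨mod n ⟩
    2^d≈1 = begin
      + (2 ^ d)                    ≡⟨ ℤ.*-identityˡ (+ (2 ^ d)) ⟨
      1ℤ ℤ.* + (2 ^ d)             ≈⟨ *-cong (≈-sym 2^μ≈1) ≈-refl ⟩
      + (2 ^ μ) ℤ.* + (2 ^ d)      ≡⟨ pos-^-distribˡ-+-* 2 μ d ⟨
      + (2 ^ (μ + d))              ≡⟨ cong (λ e → + (2 ^ e)) μ+d≡c+b ⟩
      + (2 ^ (c + b))              ≡⟨ pos-^-distribˡ-+-* 2 c b ⟩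
      + (2 ^ c) ℤ.* + (2 ^ b)      ≈⟨ *-cong (≈-refl {a = + (2 ^ c)}) (≈-sym 2^a≈2^b) ⟩
      + (2 ^ c) ℤ.* + (2 ^ a)      ≡⟨ pos-^-distribˡ-+-* 2 c a ⟨
      + (2 ^ (c + a))              ≡⟨ cong (λ e → + (2 ^ e)) (ℕ.m∸n+n≡m (ℕ.<⇒≤ (ℕ.<-trans a<b b<μ))) ⟩
      + (2 ^ μ)                    ≈⟨ 2^μ≈1 ⟩
      1ℤ                           ∎
      where open ≈-Reasoning n

  2^-injective : ∀ {a b} → a < μ → b < μ → + (2 ^ a) ≈ + (2 ^ b) ⟨mod n ⟩ → a ≡ b
  2^-injective {a} {b} a<μ b<μ 2^a≈2^b with ℕ.<-cmp a b
  ... | tri< a<b _ _ = ⊥-elim (2^-distinct a<b b<μ 2^a≈2^b)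
  ... | tri≈ _ a≡b _ = a≡b
  ... | tri> _ _ b<a = ⊥-elim (2^-distinct b<a a<μ (≈-sym 2^a≈2^b))

  -- For odd μ we would get -1 ≡ (2^h)^μ = (2^μ)^h ≡ 1.
  2∣μ : 2 ∣ μ
  2∣μ with pairExponent-exists μ
  ... | s , even = ℕ.divides s (ℕ.*-comm 2 s)
  ... | s , odd  = ⊥-elim (-1≉1 2<n (begin
    -1ℤ                           ≈⟨ ^-odd-≈-1 s 2^h≈-1 ⟨
    (+ (2 ^ h)) ℤ.^ (1 + 2 * s)     ≡⟨ cong (λ e → (+ (2 ^ h)) ℤ.^ e) (ℕ.+-comm 1 (2 * s)) ⟩
    (+ (2 ^ h)) ℤ.^ μ               ≡⟨ pos-^-*-assoc 2 h μ ⟨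
    + (2 ^ (h * μ))               ≡⟨ cong (λ e → + (2 ^ e)) (ℕ.*-comm h μ) ⟩
    + (2 ^ (μ * h))               ≡⟨ pos-^-*-assoc 2 μ h ⟩
    (+ (2 ^ μ)) ℤ.^ h               ≈⟨ ^-≈1 h 2^μ≈1 ⟩
    1ℤ                            ∎))
    where open ≈-Reasoning n

  ν : ℕ
  ν = μ / 2

  ν*2≡μ : ν * 2 ≡ μ
  ν*2≡μ = m/n*n≡m 2∣μ

  instance
    ν-nonZero : NonZero ν
    ν-nonZero = ℕ.≢-nonZero (λ ν≡0 → ℕ.<⇒≢ 0<μ (trans (sym (cong (_* 2) ν≡0)) ν*2≡μ))

    ν*2-nonZero : NonZero (ν * 2)
    ν*2-nonZero = ℕ.m*n≢0 ν 2

  2^[m*2]≈2^[m%ν*2] : ∀ m → + (2 ^ (m * 2)) ≈ + (2 ^ (m % ν * 2)) ⟨mod n ⟩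
  2^[m*2]≈2^[m%ν*2] m =
    ≈-trans (^-reduce 2 (ν * 2) (subst (λ d → + (2 ^ d) ≈ 1ℤ ⟨mod n ⟩) (sym ν*2≡μ) 2^μ≈1) (m * 2))
            (≈-reflexive (cong (λ e → + (2 ^ e)) (sym (m%n*o≡m*o%[n*o] m ν 2))))

  2^-in-pair : ∀ k → ∃ λ i → i < ν × ∃ λ e → PairExponent i e × + (2 ^ k) ≈ + (2 ^ e) ⟨mod n ⟩
  2^-in-pair k = let i , pe = pairExponent-exists (k % μ) in
    i , Equivalence.to (pairExponent-<⇔ ν pe) (subst (k % μ <_) (sym ν*2≡μ) (m%n<n k μ)) ,
    k % μ , pe , ^-reduce 2 μ 2^μ≈1 k

  exponent<μ : ∀ {i e} → PairExponent i e → InRange μ i → e < μ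
  exponent<μ {e = e} pe i∈ =
    subst (e <_) ν*2≡μ (Equivalence.from (pairExponent-<⇔ ν pe) (Equivalence.to (inRange⇔< μ) i∈))

  -2^e≈2^[e+h] : ∀ e → ℤ.- + (2 ^ e) ≈ + (2 ^ (e + h)) ⟨mod n ⟩
  -2^e≈2^[e+h] e = begin
    ℤ.- + (2 ^ e)              ≡⟨ identity (+ (2 ^ e)) ⟩
    + (2 ^ e) ℤ.* -1ℤ          ≈⟨ *-cong (≈-refl {a = + (2 ^ e)}) (≈-sym 2^h≈-1) ⟩
    + (2 ^ e) ℤ.* + (2 ^ h)    ≡⟨ pos-^-distribˡ-+-* 2 e h ⟨
    + (2 ^ (e + h))            ∎
    where
    open ≈-Reasoning n
    identity : ∀ y → ℤ.- y ≡ y ℤ.* -1ℤ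
    identity = solve-∀

  pair-members-distinct : ∀ i → InRange μ i → ¬ (2 ^ (2 * i) ≡ 2 ^ (2 * i + 1) [mod n ])
  pair-members-distinct i i∈ 2^2i≡2^[2i+1] =
    ℕ.<⇒≢ 2i<2i+1 (2^-injective (ℕ.<-trans 2i<2i+1 2i+1<μ) 2i+1<μ (≡modℤ⇒≈ 2^2i≡2^[2i+1]))
    where
    2i<2i+1 = ℕ.m<m+n (2 * i) (s≤s z≤n)
    2i+1<μ = exponent<μ odd i∈

  pairs-disjoint : ∀ i j x → InRange μ i → InRange μ j → InPair n i x → InPair n j x → i ≡ j
  pairs-disjoint i j x i∈ j∈ x∈i x∈j =
    let e , pe , x≈2^e = inPair⇒exponent {i = i} x∈i
        f , pf , x≈2^f = inPair⇒exponent {i = j} x∈j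
    in pairExponent-unique pe pf (2^-injective (exponent<μ pe i∈) (exponent<μ pf j∈) (≈-trans (≈-sym x≈2^e) x≈2^f))

  ⟨2⟩⊆pairs : ∀ x → InPow2 n x → ∃ λ i → InRange μ i × InPair n i x
  ⟨2⟩⊆pairs x (x<n , k , x≡2^k) =
    let i , i<ν , e , pe , 2^k≈2^e = 2^-in-pair k
    in i , Equivalence.from (inRange⇔< μ) i<ν , exponent⇒inPair x<n pe (≈-trans (≡modℤ⇒≈ x≡2^k) 2^k≈2^e)

  pairs⊆⟨2⟩ : ∀ x → (∃ λ i → InRange μ i × InPair n i x) → InPow2 n x
  pairs⊆⟨2⟩ x (i , _ , x∈i@(x<n , _)) = let e , _ , x≈2^e = inPair⇒exponent {i = i} x∈i in x<n , e , ≈⇒≡modℤ x≈2^e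

  ΔA⊆⟨2⟩ : ∀ x → InΔA n μ x → InPow2 n x
  ΔA⊆⟨2⟩ x (x<n , i , _ , inj₁ x≡) = x<n , 2 * i + h , ≈⇒≡modℤ (begin
    + x                                            ≈⟨ ≡modℤ⇒≈ x≡ ⟩
    + (2 ^ (2 * i)) ℤ.- + (2 ^ (2 * i + 1))        ≡⟨ 2^e-2^[e+1]≡-2^e (2 * i) ⟩
    ℤ.- + (2 ^ (2 * i))                            ≈⟨ -2^e≈2^[e+h] (2 * i) ⟩
    + (2 ^ (2 * i + h))                            ∎)
    where open ≈-Reasoning n
  ΔA⊆⟨2⟩ x (x<n , i , _ , inj₂ x≡) = x<n , 2 * i , ≈⇒≡modℤ (begin
    + x                                            ≈⟨ ≡modℤ⇒≈ x≡ ⟩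
    + (2 ^ (2 * i + 1)) ℤ.- + (2 ^ (2 * i))        ≡⟨ 2^[e+1]-2^e≡2^e (2 * i) ⟩
    + (2 ^ (2 * i))                                ∎)
    where open ≈-Reasoning n

  -- An odd exponent e is traded for the even exponent e + h via 2^e ≡ -2^(e+h).
  ⟨2⟩⊆ΔA : ∀ x → InPow2 n x → InΔA n μ x
  ⟨2⟩⊆ΔA x (x<n , k , x≡2^k) with 2^-in-pair k
  ... | i , i<ν , _ , even , 2^k≈2^2i = x<n , i , Equivalence.from (inRange⇔< μ) i<ν , inj₂ (≈⇒≡modℤ (begin
    + x                                            ≈⟨ ≡modℤ⇒≈ x≡2^k ⟩
    + (2 ^ k)                                      ≈⟨ 2^k≈2^2i ⟩
    + (2 ^ (2 * i))                                ≡⟨ 2^[e+1]-2^e≡2^e (2 * i) ⟨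
    + (2 ^ (2 * i + 1)) ℤ.- + (2 ^ (2 * i))        ∎))
    where open ≈-Reasoning n
  ... | i , _ , _ , odd , 2^k≈2^[2i+1] = x<n , j , Equivalence.from (inRange⇔< μ) (m%n<n s ν) , inj₁ (≈⇒≡modℤ (begin
    + x                                            ≈⟨ ≡modℤ⇒≈ x≡2^k ⟩
    + (2 ^ k)                                      ≈⟨ 2^k≈2^[2i+1] ⟩
    + (2 ^ (2 * i + 1))                            ≡⟨ ℤ.neg-involutive _ ⟨
    ℤ.- ℤ.- + (2 ^ (2 * i + 1))                    ≈⟨ neg-cong (-2^e≈2^[e+h] (2 * i + 1)) ⟩
    ℤ.- + (2 ^ (2 * i + 1 + h))                    ≡⟨ cong (λ e → ℤ.- + (2 ^ e)) (identity i t) ⟩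
    ℤ.- + (2 ^ (s * 2))                            ≈⟨ neg-cong (2^[m*2]≈2^[m%ν*2] s) ⟩
    ℤ.- + (2 ^ (j * 2))                            ≡⟨ cong (λ e → ℤ.- + (2 ^ e)) (ℕ.*-comm j 2) ⟩
    ℤ.- + (2 ^ (2 * j))                            ≡⟨ 2^e-2^[e+1]≡-2^e (2 * j) ⟨
    + (2 ^ (2 * j)) ℤ.- + (2 ^ (2 * j + 1))        ∎))
    where
    open ≈-Reasoning n
    s = i + t + 1
    j = s % ν
    identity : ∀ i t → 2 * i + 1 + (1 + 2 * t) ≡ (i + t + 1) * 2
    identity = ℕ-solve-∀

corollary2 : (n μ : ℕ) → C₂bar n → IsOrd n 2 μ →
    (2 ∣ μ)
    × (∀ i → InRange μ i → ¬ (2 ^ (2 * i) ≡ 2 ^ (2 * i + 1) [mod n ]))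
    × (∀ i j x → InRange μ i → InRange μ j → InPair n i x → InPair n j x → i ≡ j)
    × (∀ x → InPow2 n x ⇔ (∃ λ i → InRange μ i × InPair n i x))
    × (∀ x → InΔA n μ x ⇔ InPow2 n x)
corollary2 n μ n∈C₂bar (0<μ , 2^μ≡1 , μ-least) =
  2∣μ , pair-members-distinct , pairs-disjoint ,
  (λ x → mk⇔ (⟨2⟩⊆pairs x) (pairs⊆⟨2⟩ x)) , (λ x → mk⇔ (ΔA⊆⟨2⟩ x) (⟨2⟩⊆ΔA x))
  where
  2^odd≈-1 = C₂bar⇒2^odd≈-1 n∈C₂bar
  open PowersOfTwo 0<μ 2^μ≡1 μ-least (C₂bar⇒2< n∈C₂bar) {proj₁ 2^odd≈-1} (proj₂ 2^odd≈-1)
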